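{- For every valuation $v$ over the matrix $\mathcal{M}_6$, the map $\rho_v:For(\Sigma)\to\{0,1\}$ given by $\rho_v(A)=v(A)_1$ is a bivaluation for $LET_K^+$, and for every formula $A$: $\rho_v(A)=1$ if and only if $v(A)\in\mathrm{D}$.
   Context: $For(\Sigma)$ is the set of formulas over a denumerable set of propositional variables and $\Sigma=\{\land,\lor,\to,\neg,\circ\}$. Let $\{0,1\}$ be the two-element Boolean algebra with $\sqcap,\sqcup,\sim$ and $a\Rightarrow b=\sim a\sqcup b$. $\mathcal{M}_6$ is the logical matrix with domain $B_{LET_K}=\{z\in\{0,1\}^3:z_3\le z_1\sqcup z_2,\ z_1\sqcap z_2\sqcap z_3=0\}=\{T=(1,0,1),T_0=(1,0,0),\mathsf{b}=(1,1,0),\mathsf{n}=(0,0,0),F_0=(0,1,0),F=(0,1,1)\}$, designated set $\mathrm{D}=\{z:z_1=1\}=\{T,T_0,\mathsf{b}\}$, and operations: $z\tilde\land w=(z_1\sqcap w_1,\ z_2\sqcup w_2,\ (z_1\sqcap z_3\sqcap w_1\sqcap w_3)\sqcup(z_2\sqcap z_3)\sqcup(w_2\sqcap w_3))$; $z\tilde\lor w=(z_1\sqcup w_1,\ z_2\sqcap w_2,\ (z_2\sqcap z_3\sqcap w_2\sqcap w_3)\sqcup(z_1\sqcap z_3)\sqcup(w_1\sqcap w_3))$; $z\tilde\to w=(z_1\Rightarrow w_1,\ z_1\sqcap w_2,\ (z_1\sqcap w_2\sqcap w_3)\sqcup(z_2\sqcap z_3)\sqcup(w_1\sqcap w_3))$;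 $\tilde\neg z=(z_2,z_1,z_3)$; $\tilde\circ z=(z_3,\sim z_3,1)$. A valuation over $\mathcal{M}_6$ is a homomorphism $v$ from the formula algebra into this algebra. A bivaluation for $LET_K$ is $\rho:For(\Sigma)\to\{0,1\}$ with: (v1) $\rho(A\land B)=1$ iff $\rho(A)=\rho(B)=1$; (v2) $\rho(A\lor B)=1$ iff $\rho(A)=1$ or $\rho(B)=1$; (v3) $\rho(A\to B)=1$ iff $\rho(A)=0$ or $\rho(B)=1$; (v4) $\rho(\neg\neg A)=1$ iff $\rho(A)=1$; (v5) $\rho(\neg(A\land B))=1$ iff $\rho(\neg A)=1$ or $\rho(\neg B)=1$; (v6) $\rho(\neg(A\lor B))=1$ iff $\rho(\neg A)=\rho(\neg B)=1$; (v7) $\rho(\neg(A\to B))=1$ iff $\rho(A)=\rho(\neg B)=1$; (v8) if $\rho(\circ A)=1$ then ($\rho(\neg A)=1$ iff $\rho(A)=0$). A bivaluation for $LET_K^+$ is a bivaluation for $LET_K$ satisfying moreover, for all $A,B$: (vp1) $\rho(\circ\circ A)=1$; (vp2) $\rho(\circ\neg A)=\rho(\circ A)$; (vp3) if $\rho(\circ A)=\rho(A)=1$ and $\rho(\circ B)=\rho(B)=1$ then $\rho(\circ(A\land B))=1$; (vp4) if $\rho(\circ A)=\rho(\neg A)=1$ then $\rho(\circ(A\land B))=1$; (vp5) if $\rho(\circ B)=\rho(\neg B)=1$ then $\rho(\circ(A\land B))=1$; (vp6) if $\rho(\circ(A\land B))=\rho(A)=\rho(B)=1$ then $\rho(\circ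 A)=\rho(\circ B)=1$; (vp7) if $\rho(\circ(A\land B))=1$ and ($\rho(\neg A)=1$ or $\rho(\neg B)=1$) then ($\rho(\circ A)=\rho(\neg A)=1$ or $\rho(\circ B)=\rho(\neg B)=1$); (vp8) if $\rho(\circ A)=\rho(A)=1$ then $\rho(\circ(A\lor B))=1$; (vp9) if $\rho(\circ B)=\rho(B)=1$ then $\rho(\circ(A\lor B))=1$; (vp10) if $\rho(\circ A)=\rho(\neg A)=1$ and $\rho(\circ B)=\rho(\neg B)=1$ then $\rho(\circ(A\lor B))=1$; (vp11) if $\rho(\circ(A\lor B))=1$ and ($\rho(A)=1$ or $\rho(B)=1$) then ($\rho(\circ A)=\rho(A)=1$ or $\rho(\circ B)=\rho(B)=1$); (vp12) if $\rho(\circ(A\lor B))=1$ and $\rho(A)=\rho(B)=0$ then $\rho(\circ A)=\rho(\circ B)=1$; (vp13) if $\rho(\circ A)=\rho(\neg A)=1$ then $\rho(\circ(A\to B))=1$; (vp14) if $\rho(\circ B)=\rho(B)=1$ then $\rho(\circ(A\to B))=1$; (vp15) if $\rho(A)=1$ and $\rho(\circ B)=\rho(\neg B)=1$ then $\rho(\circ(A\to B))=1$; (vp16) if $\rho(\circ(A\to B))=1$ and ($\rho(A)=0$ or $\rho(B)=1$) then ($\rho(\circ A)=\rho(\neg A)=1$ or $\rho(\circ B)=\rho(B)=1$); (vp17) if $\rho(\circ(A\to B))=1$ and $\rho(A)=\rho(\neg B)=1$ then $\rho(\circ B)=1$. -}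

module Defs where

open import Data.Nat using (ℕ)
open import Data.Bool using (Bool; true; false; _∧_; _∨_; not; T)
open import Data.Product using (_×_; _,_; proj₁; proj₂)
open import Data.Sum using (_⊎_)
open import Relation.Binary.PropositionalEquality using (_≡_; refl)
open import Function.Bundles using (_⇔_)

data For : Set where
  var  : ℕ → For
  _∧'_ : For → For → For
  _∨'_ : For → For → For
  _⇒'_ : For → For → For
  ¬'_  : For → For
  ∘'_  : For → For

-- Boolean algebra {0,1} = Bool (0 = false, 1 = true); ⊓ = ∧, ⊔ = ∨, ∼ = not
_⇛_ : Bool → Bool → Bool
a ⇛ b = not a ∨ b

Triple : Set
Triple = Bool × Bool × Bool

π₁ π₂ π₃ : Triple → Bool
π₁ (a , _ , _) = a
π₂ (_ , b , _) = b
π₃ (_ , _ , c) = c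

InB : Triple → Set
InB z = ((π₃ z ⇛ (π₁ z ∨ π₂ z)) ≡ true) × ((π₁ z ∧ π₂ z ∧ π₃ z) ≡ false)

record B6 : Set where
  constructor ⟨_,_⟩
  field
    elt : Triple
    inB : InB elt
open B6 public

z₁ z₂ z₃ : B6 → Bool
z₁ z = π₁ (elt z)
z₂ z = π₂ (elt z)
z₃ z = π₃ (elt z)

Designated : B6 → Set
Designated z = z₁ z ≡ true

andT orT impT : Triple → Triple → Triple
andT (z1 , z2 , z3) (w1 , w2 , w3) =
  (z1 ∧ w1) , (z2 ∨ w2) , ((z1 ∧ z3 ∧ w1 ∧ w3) ∨ (z2 ∧ z3) ∨ (w2 ∧ w3))
orT (z1 , z2 , z3) (w1 , w2 , w3) =
  (z1 ∨ w1) , (z2 ∧ w2) , ((z2 ∧ z3 ∧ w2 ∧ w3) ∨ (z1 ∧ z3) ∨ (w1 ∧ w3))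
impT (z1 , z2 , z3) (w1 , w2 , w3) =
  (z1 ⇛ w1) , (z1 ∧ w2) , ((z1 ∧ w2 ∧ w3) ∨ (z2 ∧ z3) ∨ (w1 ∧ w3))

negT circT : Triple → Triple
negT (z1 , z2 , z3) = z2 , z1 , z3
circT (z1 , z2 , z3) = z3 , not z3 , true

andT-B : ∀ z w → InB z → InB w → InB (andT z w)
andT-B (true , true , true) _ (_ , ()) _
andT-B _ (true , true , true) _ (_ , ())
andT-B (false , false , true) _ (() , _) _
andT-B _ (false , false , true) _ (() , _)
andT-B (true , false , true) (true , false , true) _ _ = refl , refl
andT-B (true , false , true) (true , false , false) _ _ = refl , refl
andT-B (true , false , true) (true , true , false) _ _ = refl , refl
andT-B (true , false , true) (false , false , false) _ _ = refl , refl
andT-B (true , false , true) (false , true , false) _ _ = refl , refl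
andT-B (true , false , true) (false , true , true) _ _ = refl , refl
andT-B (true , false , false) (true , false , true) _ _ = refl , refl
andT-B (true , false , false) (true , false , false) _ _ = refl , refl
andT-B (true , false , false) (true , true , false) _ _ = refl , refl
andT-B (true , false , false) (false , false , false) _ _ = refl , refl
andT-B (true , false , false) (false , true , false) _ _ = refl , refl
andT-B (true , false , false) (false , true , true) _ _ = refl , refl
andT-B (true , true , false) (true , false , true) _ _ = refl , refl
andT-B (true , true , false) (true , false , false) _ _ = refl , refl
andT-B (true , true , false) (true , true , false) _ _ = refl , refl
andT-B (true , true , false) (false , false , false) _ _ = refl , refl
andT-B (true , true , false) (false , true , false) _ _ = refl , refl
andT-B (true , true , false) (false , true , true) _ _ = refl , refl
andT-B (false , false , false) (true , false , true) _ _ = refl , refl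
andT-B (false , false , false) (true , false , false) _ _ = refl , refl
andT-B (false , false , false) (true , true , false) _ _ = refl , refl
andT-B (false , false , false) (false , false , false) _ _ = refl , refl
andT-B (false , false , false) (false , true , false) _ _ = refl , refl
andT-B (false , false , false) (false , true , true) _ _ = refl , refl
andT-B (false , true , false) (true , false , true) _ _ = refl , refl
andT-B (false , true , false) (true , false , false) _ _ = refl , refl
andT-B (false , true , false) (true , true , false) _ _ = refl , refl
andT-B (false , true , false) (false , false , false) _ _ = refl , refl
andT-B (false , true , false) (false , true , false) _ _ = refl , refl
andT-B (false , true , false) (false , true , true) _ _ = refl , refl
andT-B (false , true , true) (true , false , true) _ _ = refl , refl
andT-B (false , true , true) (true , false , false) _ _ = refl , refl
andT-B (false , true , true) (true , true , false) _ _ = refl , refl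
andT-B (false , true , true) (false , false , false) _ _ = refl , refl
andT-B (false , true , true) (false , true , false) _ _ = refl , refl
andT-B (false , true , true) (false , true , true) _ _ = refl , refl

orT-B : ∀ z w → InB z → InB w → InB (orT z w)
orT-B (true , true , true) _ (_ , ()) _
orT-B _ (true , true , true) _ (_ , ())
orT-B (false , false , true) _ (() , _) _
orT-B _ (false , false , true) _ (() , _)
orT-B (true , false , true) (true , false , true) _ _ = refl , refl
orT-B (true , false , true) (true , false , false) _ _ = refl , refl
orT-B (true , false , true) (true , true , false) _ _ = refl , refl
orT-B (true , false , true) (false , false , false) _ _ = refl , refl
orT-B (true , false , true) (false , true , false) _ _ = refl , refl
orT-B (true , false , true) (false , true , true) _ _ = refl , refl
orT-B (true , false , false) (true , false , true) _ _ = refl , refl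
orT-B (true , false , false) (true , false , false) _ _ = refl , refl
orT-B (true , false , false) (true , true , false) _ _ = refl , refl
orT-B (true , false , false) (false , false , false) _ _ = refl , refl
orT-B (true , false , false) (false , true , false) _ _ = refl , refl
orT-B (true , false , false) (false , true , true) _ _ = refl , refl
orT-B (true , true , false) (true , false , true) _ _ = refl , refl
orT-B (true , true , false) (true , false , false) _ _ = refl , refl
orT-B (true , true , false) (true , true , false) _ _ = refl , refl
orT-B (true , true , false) (false , false , false) _ _ = refl , refl
orT-B (true , true , false) (false , true , false) _ _ = refl , refl
orT-B (true , true , false) (false , true , true) _ _ = refl , refl
orT-B (false , false , false) (true , false , true) _ _ = refl , refl
orT-B (false , false , false) (true , false , false) _ _ = refl , refl
orT-B (false , false , false) (true , true , false) _ _ = refl , refl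
orT-B (false , false , false) (false , false , false) _ _ = refl , refl
orT-B (false , false , false) (false , true , false) _ _ = refl , refl
orT-B (false , false , false) (false , true , true) _ _ = refl , refl
orT-B (false , true , false) (true , false , true) _ _ = refl , refl
orT-B (false , true , false) (true , false , false) _ _ = refl , refl
orT-B (false , true , false) (true , true , false) _ _ = refl , refl
orT-B (false , true , false) (false , false , false) _ _ = refl , refl
orT-B (false , true , false) (false , true , false) _ _ = refl , refl
orT-B (false , true , false) (false , true , true) _ _ = refl , refl
orT-B (false , true , true) (true , false , true) _ _ = refl , refl
orT-B (false , true , true) (true , false , false) _ _ = refl , refl
orT-B (false , true , true) (true , true , false) _ _ = refl , refl
orT-B (false , true , true) (false , false , false) _ _ = refl , refl
orT-B (false , true , true) (false , true , false) _ _ = refl , refl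
orT-B (false , true , true) (false , true , true) _ _ = refl , refl

impT-B : ∀ z w → InB z → InB w → InB (impT z w)
impT-B (true , true , true) _ (_ , ()) _
impT-B _ (true , true , true) _ (_ , ())
impT-B (false , false , true) _ (() , _) _
impT-B _ (false , false , true) _ (() , _)
impT-B (true , false , true) (true , false , true) _ _ = refl , refl
impT-B (true , false , true) (true , false , false) _ _ = refl , refl
impT-B (true , false , true) (true , true , false) _ _ = refl , refl
impT-B (true , false , true) (false , false , false) _ _ = refl , refl
impT-B (true , false , true) (false , true , false) _ _ = refl , refl
impT-B (true , false , true) (false , true , true) _ _ = refl , refl
impT-B (true , false , false) (true , false , true) _ _ = refl , refl
impT-B (true , false , false) (true , false , false) _ _ = refl , refl
impT-B (true , false , false) (true , true , false) _ _ = refl , refl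
impT-B (true , false , false) (false , false , false) _ _ = refl , refl
impT-B (true , false , false) (false , true , false) _ _ = refl , refl
impT-B (true , false , false) (false , true , true) _ _ = refl , refl
impT-B (true , true , false) (true , false , true) _ _ = refl , refl
impT-B (true , true , false) (true , false , false) _ _ = refl , refl
impT-B (true , true , false) (true , true , false) _ _ = refl , refl
impT-B (true , true , false) (false , false , false) _ _ = refl , refl
impT-B (true , true , false) (false , true , false) _ _ = refl , refl
impT-B (true , true , false) (false , true , true) _ _ = refl , refl
impT-B (false , false , false) (true , false , true) _ _ = refl , refl
impT-B (false , false , false) (true , false , false) _ _ = refl , refl
impT-B (false , false , false) (true , true , false) _ _ = refl , refl
impT-B (false , false , false) (false , false , false) _ _ = refl , refl
impT-B (false , false , false) (false , true , false) _ _ = refl , refl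
impT-B (false , false , false) (false , true , true) _ _ = refl , refl
impT-B (false , true , false) (true , false , true) _ _ = refl , refl
impT-B (false , true , false) (true , false , false) _ _ = refl , refl
impT-B (false , true , false) (true , true , false) _ _ = refl , refl
impT-B (false , true , false) (false , false , false) _ _ = refl , refl
impT-B (false , true , false) (false , true , false) _ _ = refl , refl
impT-B (false , true , false) (false , true , true) _ _ = refl , refl
impT-B (false , true , true) (true , false , true) _ _ = refl , refl
impT-B (false , true , true) (true , false , false) _ _ = refl , refl
impT-B (false , true , true) (true , true , false) _ _ = refl , refl
impT-B (false , true , true) (false , false , false) _ _ = refl , refl
impT-B (false , true , true) (false , true , false) _ _ = refl , refl
impT-B (false , true , true) (false , true , true) _ _ = refl , refl

negT-B : ∀ z → InB z → InB (negT z)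
negT-B (true , true , true) (_ , ())
negT-B (false , false , true) (() , _)
negT-B (true , false , true) _ = refl , refl
negT-B (true , false , false) _ = refl , refl
negT-B (true , true , false) _ = refl , refl
negT-B (false , false , false) _ = refl , refl
negT-B (false , true , false) _ = refl , refl
negT-B (false , true , true) _ = refl , refl

circT-B : ∀ z → InB z → InB (circT z)
circT-B (true , true , true) (_ , ())
circT-B (false , false , true) (() , _)
circT-B (true , false , true) _ = refl , refl
circT-B (true , false , false) _ = refl , refl
circT-B (true , true , false) _ = refl , refl
circT-B (false , false , false) _ = refl , refl
circT-B (false , true , false) _ = refl , refl
circT-B (false , true , true) _ = refl , refl

_∧̃_ _∨̃_ _→̃_ : B6 → B6 → B6
⟨ z , p ⟩ ∧̃ ⟨ w , q ⟩ = ⟨ andT z w , andT-B z w p q ⟩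
⟨ z , p ⟩ ∨̃ ⟨ w , q ⟩ = ⟨ orT z w , orT-B z w p q ⟩
⟨ z , p ⟩ →̃ ⟨ w , q ⟩ = ⟨ impT z w , impT-B z w p q ⟩

¬̃_ ∘̃_ : B6 → B6
¬̃ ⟨ z , p ⟩ = ⟨ negT z , negT-B z p ⟩
∘̃ ⟨ z , p ⟩ = ⟨ circT z , circT-B z p ⟩

record IsValuation (v : For → B6) : Set where
  field
    hom-∧ : ∀ A B → v (A ∧' B) ≡ v A ∧̃ v B
    hom-∨ : ∀ A B → v (A ∨' B) ≡ v A ∨̃ v B
    hom-⇒ : ∀ A B → v (A ⇒' B) ≡ v A →̃ v B
    hom-¬ : ∀ A → v (¬' A) ≡ ¬̃ v A
    hom-∘ : ∀ A → v (∘' A) ≡ ∘̃ v A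

record IsBivaluationLETK (ρ : For → Bool) : Set where
  field
    v1 : ∀ A B → ρ (A ∧' B) ≡ true ⇔ (ρ A ≡ true × ρ B ≡ true)
    v2 : ∀ A B → ρ (A ∨' B) ≡ true ⇔ (ρ A ≡ true ⊎ ρ B ≡ true)
    v3 : ∀ A B → ρ (A ⇒' B) ≡ true ⇔ (ρ A ≡ false ⊎ ρ B ≡ true)
    v4 : ∀ A → ρ (¬' ¬' A) ≡ true ⇔ ρ A ≡ true
    v5 : ∀ A B → ρ (¬' (A ∧' B)) ≡ true ⇔ (ρ (¬' A) ≡ true ⊎ ρ (¬' B) ≡ true)
    v6 : ∀ A B → ρ (¬' (A ∨' B)) ≡ true ⇔ (ρ (¬' A) ≡ true × ρ (¬' B) ≡ true)
    v7 : ∀ A B → ρ (¬' (A ⇒' B)) ≡ true ⇔ (ρ A ≡ true × ρ (¬' B) ≡ true)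
    v8 : ∀ A → ρ (∘' A) ≡ true → (ρ (¬' A) ≡ true ⇔ ρ A ≡ false)

record IsBivaluationLETK⁺ (ρ : For → Bool) : Set where
  field
    isBivLETK : IsBivaluationLETK ρ
    vp1 : ∀ A → ρ (∘' ∘' A) ≡ true
    vp2 : ∀ A → ρ (∘' ¬' A) ≡ ρ (∘' A)
    vp3 : ∀ A B → ρ (∘' A) ≡ true → ρ A ≡ true → ρ (∘' B) ≡ true → ρ B ≡ true →
          ρ (∘' (A ∧' B)) ≡ true
    vp4 : ∀ A B → ρ (∘' A) ≡ true → ρ (¬' A) ≡ true → ρ (∘' (A ∧' B)) ≡ true
    vp5 : ∀ A B → ρ (∘' B) ≡ true → ρ (¬' B) ≡ true → ρ (∘' (A ∧' B)) ≡ true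
    vp6 : ∀ A B → ρ (∘' (A ∧' B)) ≡ true → ρ A ≡ true → ρ B ≡ true →
          ρ (∘' A) ≡ true × ρ (∘' B) ≡ true
    vp7 : ∀ A B → ρ (∘' (A ∧' B)) ≡ true → (ρ (¬' A) ≡ true ⊎ ρ (¬' B) ≡ true) →
          (ρ (∘' A) ≡ true × ρ (¬' A) ≡ true) ⊎ (ρ (∘' B) ≡ true × ρ (¬' B) ≡ true)
    vp8 : ∀ A B → ρ (∘' A) ≡ true → ρ A ≡ true → ρ (∘' (A ∨' B)) ≡ true
    vp9 : ∀ A B → ρ (∘' B) ≡ true → ρ B ≡ true → ρ (∘' (A ∨' B)) ≡ true
    vp10 : ∀ A B → ρ (∘' A) ≡ true → ρ (¬' A) ≡ true → ρ (∘' B) ≡ true → ρ (¬' B) ≡ true →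
           ρ (∘' (A ∨' B)) ≡ true
    vp11 : ∀ A B → ρ (∘' (A ∨' B)) ≡ true → (ρ A ≡ true ⊎ ρ B ≡ true) →
           (ρ (∘' A) ≡ true × ρ A ≡ true) ⊎ (ρ (∘' B) ≡ true × ρ B ≡ true)
    vp12 : ∀ A B → ρ (∘' (A ∨' B)) ≡ true → ρ A ≡ false → ρ B ≡ false →
           ρ (∘' A) ≡ true × ρ (∘' B) ≡ true
    vp13 : ∀ A B → ρ (∘' A) ≡ true → ρ (¬' A) ≡ true → ρ (∘' (A ⇒' B)) ≡ true
    vp14 : ∀ A B → ρ (∘' B) ≡ true → ρ B ≡ true → ρ (∘' (A ⇒' B)) ≡ true
    vp15 : ∀ A B → ρ A ≡ true → ρ (∘' B) ≡ true → ρ (¬' B) ≡ true → ρ (∘' (A ⇒' B)) ≡ true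
    vp16 : ∀ A B → ρ (∘' (A ⇒' B)) ≡ true → (ρ A ≡ false ⊎ ρ B ≡ true) →
           (ρ (∘' A) ≡ true × ρ (¬' A) ≡ true) ⊎ (ρ (∘' B) ≡ true × ρ B ≡ true)
    vp17 : ∀ A B → ρ (∘' (A ⇒' B)) ≡ true → ρ A ≡ true → ρ (¬' B) ≡ true →
           ρ (∘' B) ≡ true

ρ_ : (For → B6) → For → Bool
(ρ v) A = z₁ (v A)

{-# OPTIONS --safe #-}
module Submission where

-- ρ_v reads off the first coordinate, so each clause becomes a property of the six-element
-- matrix. The first two coordinates of the operations are computed by the Boolean connectives,
-- which gives (v1)–(v7). The third coordinate marks the classical values T and F:
-- z₃ (x ∧̃ y) = 1 iff x = y = T or one of x, y is F, dually for ∨̃, and z₃ (x →̃ y) = 1 iff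
-- x is designated and y = F, or x = F, or y = T. Together with the consistency of T and F
-- (F is not designated, nor is ¬̃ T) this yields (v8) and (vp1)–(vp17).

open import Defs
open import Data.Bool using (true; false; _∧_; _∨_)
open import Data.Empty using (⊥-elim)
open import Data.Product using (_×_; _,_; proj₂)
open import Data.Product.Function.NonDependent.Propositional using (_×-⇔_)
open import Data.Sum using (_⊎_; inj₁; inj₂; [_,_])
open import Data.Sum.Function.Propositional using (_⊎-⇔_)
open import Function using (id)
open import Function.Bundles using (_⇔_; mk⇔; Equivalence)
open import Function.Properties.Equivalence using () renaming (refl to ⇔-refl; trans to ⇔-trans)
open import Relation.Binary.PropositionalEquality using (_≡_; refl; sym; trans)
open import Relation.Nullary using (¬_; contradiction)

open Equivalence using (to; from)

∧-≡-true : ∀ a {b} → a ∧ b ≡ true ⇔ (a ≡ true × b ≡ true)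
∧-≡-true true  = mk⇔ (refl ,_) proj₂
∧-≡-true false = mk⇔ (λ ()) λ { (() , _) }

∧∧-≡-true : ∀ a b {c} → a ∧ b ∧ c ≡ true ⇔ ((a ≡ true × b ≡ true) × c ≡ true)
∧∧-≡-true true  true  = mk⇔ ((refl , refl) ,_) proj₂
∧∧-≡-true true  false = mk⇔ (λ ()) λ { ((_ , ()) , _) }
∧∧-≡-true false _     = mk⇔ (λ ()) λ { ((() , _) , _) }

∨-≡-true : ∀ a {b} → a ∨ b ≡ true ⇔ (a ≡ true ⊎ b ≡ true)
∨-≡-true true  = mk⇔ (λ _ → inj₁ refl) (λ _ → refl)
∨-≡-true false = mk⇔ inj₂ [ (λ ()) , id ]

∨∨-≡-true : ∀ a b {c} → a ∨ b ∨ c ≡ true ⇔ (a ≡ true ⊎ b ≡ true ⊎ c ≡ true)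
∨∨-≡-true a b = ⇔-trans (∨-≡-true a) (⇔-refl ⊎-⇔ ∨-≡-true b)

⇛-≡-true : ∀ a {b} → (a ⇛ b) ≡ true ⇔ (a ≡ false ⊎ b ≡ true)
⇛-≡-true true  = mk⇔ inj₂ [ (λ ()) , id ]
⇛-≡-true false = mk⇔ (λ _ → inj₁ refl) (λ _ → refl)

-- On B_{LET_K} these hold exactly for x = T and x = F respectively.
IsT IsF : B6 → Set
IsT x = z₁ x ≡ true × z₃ x ≡ true
IsF x = z₂ x ≡ true × z₃ x ≡ true

IsF⇒¬Designated : ∀ x → IsF x → ¬ Designated x
IsF⇒¬Designated ⟨ _ , (_ , ()) ⟩ (refl , refl) refl

IsT⇒¬Designated-¬̃ : ∀ x → IsT x → ¬ Designated (¬̃ x)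
IsT⇒¬Designated-¬̃ ⟨ _ , (_ , ()) ⟩ (refl , refl) refl

z₃≡true⇒z₂≡true⇔z₁≡false : ∀ x → z₃ x ≡ true → (z₂ x ≡ true ⇔ z₁ x ≡ false)
z₃≡true⇒z₂≡true⇔z₁≡false ⟨ (true , false , true) , _ ⟩ _ = mk⇔ (λ ()) (λ ())
z₃≡true⇒z₂≡true⇔z₁≡false ⟨ (false , true , true) , _ ⟩ _ = mk⇔ (λ _ → refl) (λ _ → refl)
z₃≡true⇒z₂≡true⇔z₁≡false ⟨ (true , true , true) , (_ , ()) ⟩ _
z₃≡true⇒z₂≡true⇔z₁≡false ⟨ (false , false , true) , (() , _) ⟩ _

z₃-∧̃ : ∀ x y → z₃ (x ∧̃ y) ≡ true ⇔ ((IsT x × IsT y) ⊎ IsF x ⊎ IsF y)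
z₃-∧̃ x y = ⇔-trans (∨∨-≡-true _ _)
  (⇔-trans (∧∧-≡-true (z₁ x) (z₃ x)) (⇔-refl ×-⇔ ∧-≡-true (z₁ y))
    ⊎-⇔ ∧-≡-true (z₂ x) ⊎-⇔ ∧-≡-true (z₂ y))

z₃-∨̃ : ∀ x y → z₃ (x ∨̃ y) ≡ true ⇔ ((IsF x × IsF y) ⊎ IsT x ⊎ IsT y)
z₃-∨̃ x y = ⇔-trans (∨∨-≡-true _ _)
  (⇔-trans (∧∧-≡-true (z₂ x) (z₃ x)) (⇔-refl ×-⇔ ∧-≡-true (z₂ y))
    ⊎-⇔ ∧-≡-true (z₁ x) ⊎-⇔ ∧-≡-true (z₁ y))

z₃-→̃ : ∀ x y → z₃ (x →̃ y) ≡ true ⇔ ((Designated x × IsF y) ⊎ IsF x ⊎ IsT y)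
z₃-→̃ x y = ⇔-trans (∨∨-≡-true _ _)
  (⇔-trans (∧-≡-true (z₁ x)) (⇔-refl ×-⇔ ∧-≡-true (z₂ y))
    ⊎-⇔ ∧-≡-true (z₂ x) ⊎-⇔ ∧-≡-true (z₁ y))

module _ {v : For → B6} (hv : IsValuation v) where
  open IsValuation hv

  ρ-isBivaluationLETK : IsBivaluationLETK (ρ v)
  IsBivaluationLETK.v1 ρ-isBivaluationLETK A B rewrite hom-∧ A B = ∧-≡-true (z₁ (v A))
  IsBivaluationLETK.v2 ρ-isBivaluationLETK A B rewrite hom-∨ A B = ∨-≡-true (z₁ (v A))
  IsBivaluationLETK.v3 ρ-isBivaluationLETK A B rewrite hom-⇒ A B = ⇛-≡-true (z₁ (v A))
  IsBivaluationLETK.v4 ρ-isBivaluationLETK A rewrite hom-¬ (¬' A) | hom-¬ A = ⇔-refl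
  IsBivaluationLETK.v5 ρ-isBivaluationLETK A B
    rewrite hom-¬ (A ∧' B) | hom-∧ A B | hom-¬ A | hom-¬ B = ∨-≡-true (z₂ (v A))
  IsBivaluationLETK.v6 ρ-isBivaluationLETK A B
    rewrite hom-¬ (A ∨' B) | hom-∨ A B | hom-¬ A | hom-¬ B = ∧-≡-true (z₂ (v A))
  IsBivaluationLETK.v7 ρ-isBivaluationLETK A B
    rewrite hom-¬ (A ⇒' B) | hom-⇒ A B | hom-¬ B = ∧-≡-true (z₁ (v A))
  IsBivaluationLETK.v8 ρ-isBivaluationLETK A
    rewrite hom-∘ A | hom-¬ A = z₃≡true⇒z₂≡true⇔z₁≡false (v A)

  ρ-isBivaluationLETK⁺ : IsBivaluationLETK⁺ (ρ v)
  IsBivaluationLETK⁺.isBivLETK ρ-isBivaluationLETK⁺ = ρ-isBivaluationLETK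
  IsBivaluationLETK⁺.vp1 ρ-isBivaluationLETK⁺ A rewrite hom-∘ (∘' A) | hom-∘ A = refl
  IsBivaluationLETK⁺.vp2 ρ-isBivaluationLETK⁺ A rewrite hom-∘ (¬' A) | hom-¬ A | hom-∘ A = refl
  IsBivaluationLETK⁺.vp3 ρ-isBivaluationLETK⁺ A B ∘A a ∘B b
    rewrite hom-∘ (A ∧' B) | hom-∧ A B | hom-∘ A | hom-∘ B
    = from (z₃-∧̃ (v A) (v B)) (inj₁ ((a , ∘A) , (b , ∘B)))
  IsBivaluationLETK⁺.vp4 ρ-isBivaluationLETK⁺ A B ∘A ¬A
    rewrite hom-∘ (A ∧' B) | hom-∧ A B | hom-∘ A | hom-¬ A
    = from (z₃-∧̃ (v A) (v B)) (inj₂ (inj₁ (¬A , ∘A)))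
  IsBivaluationLETK⁺.vp5 ρ-isBivaluationLETK⁺ A B ∘B ¬B
    rewrite hom-∘ (A ∧' B) | hom-∧ A B | hom-∘ B | hom-¬ B
    = from (z₃-∧̃ (v A) (v B)) (inj₂ (inj₂ (¬B , ∘B)))
  IsBivaluationLETK⁺.vp6 ρ-isBivaluationLETK⁺ A B h a b
    rewrite hom-∘ (A ∧' B) | hom-∧ A B | hom-∘ A | hom-∘ B
    with to (z₃-∧̃ (v A) (v B)) h
  ... | inj₁ ((_ , ∘A) , (_ , ∘B)) = ∘A , ∘B
  ... | inj₂ (inj₁ F-A) = ⊥-elim (IsF⇒¬Designated (v A) F-A a)
  ... | inj₂ (inj₂ F-B) = ⊥-elim (IsF⇒¬Designated (v B) F-B b)
  IsBivaluationLETK⁺.vp7 ρ-isBivaluationLETK⁺ A B h ¬A⊎¬B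
    rewrite hom-∘ (A ∧' B) | hom-∧ A B | hom-∘ A | hom-¬ A | hom-∘ B | hom-¬ B
    with to (z₃-∧̃ (v A) (v B)) h
  ... | inj₁ (T-A , T-B) =
    ⊥-elim ([ IsT⇒¬Designated-¬̃ (v A) T-A , IsT⇒¬Designated-¬̃ (v B) T-B ] ¬A⊎¬B)
  ... | inj₂ (inj₁ (¬A , ∘A)) = inj₁ (∘A , ¬A)
  ... | inj₂ (inj₂ (¬B , ∘B)) = inj₂ (∘B , ¬B)
  IsBivaluationLETK⁺.vp8 ρ-isBivaluationLETK⁺ A B ∘A a
    rewrite hom-∘ (A ∨' B) | hom-∨ A B | hom-∘ A
    = from (z₃-∨̃ (v A) (v B)) (inj₂ (inj₁ (a , ∘A)))
  IsBivaluationLETK⁺.vp9 ρ-isBivaluationLETK⁺ A B ∘B b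
    rewrite hom-∘ (A ∨' B) | hom-∨ A B | hom-∘ B
    = from (z₃-∨̃ (v A) (v B)) (inj₂ (inj₂ (b , ∘B)))
  IsBivaluationLETK⁺.vp10 ρ-isBivaluationLETK⁺ A B ∘A ¬A ∘B ¬B
    rewrite hom-∘ (A ∨' B) | hom-∨ A B | hom-∘ A | hom-¬ A | hom-∘ B | hom-¬ B
    = from (z₃-∨̃ (v A) (v B)) (inj₁ ((¬A , ∘A) , (¬B , ∘B)))
  IsBivaluationLETK⁺.vp11 ρ-isBivaluationLETK⁺ A B h a⊎b
    rewrite hom-∘ (A ∨' B) | hom-∨ A B | hom-∘ A | hom-∘ B
    with to (z₃-∨̃ (v A) (v B)) h
  ... | inj₁ (F-A , F-B) =
    ⊥-elim ([ IsF⇒¬Designated (v A) F-A , IsF⇒¬Designated (v B) F-B ] a⊎b)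
  ... | inj₂ (inj₁ (a , ∘A)) = inj₁ (∘A , a)
  ... | inj₂ (inj₂ (b , ∘B)) = inj₂ (∘B , b)
  IsBivaluationLETK⁺.vp12 ρ-isBivaluationLETK⁺ A B h ¬a ¬b
    rewrite hom-∘ (A ∨' B) | hom-∨ A B | hom-∘ A | hom-∘ B
    with to (z₃-∨̃ (v A) (v B)) h
  ... | inj₁ ((_ , ∘A) , (_ , ∘B)) = ∘A , ∘B
  ... | inj₂ (inj₁ (a , _)) = contradiction (trans (sym a) ¬a) λ ()
  ... | inj₂ (inj₂ (b , _)) = contradiction (trans (sym b) ¬b) λ ()
  IsBivaluationLETK⁺.vp13 ρ-isBivaluationLETK⁺ A B ∘A ¬A
    rewrite hom-∘ (A ⇒' B) | hom-⇒ A B | hom-∘ A | hom-¬ A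
    = from (z₃-→̃ (v A) (v B)) (inj₂ (inj₁ (¬A , ∘A)))
  IsBivaluationLETK⁺.vp14 ρ-isBivaluationLETK⁺ A B ∘B b
    rewrite hom-∘ (A ⇒' B) | hom-⇒ A B | hom-∘ B
    = from (z₃-→̃ (v A) (v B)) (inj₂ (inj₂ (b , ∘B)))
  IsBivaluationLETK⁺.vp15 ρ-isBivaluationLETK⁺ A B a ∘B ¬B
    rewrite hom-∘ (A ⇒' B) | hom-⇒ A B | hom-∘ B | hom-¬ B
    = from (z₃-→̃ (v A) (v B)) (inj₁ (a , (¬B , ∘B)))
  IsBivaluationLETK⁺.vp16 ρ-isBivaluationLETK⁺ A B h ¬a⊎b
    rewrite hom-∘ (A ⇒' B) | hom-⇒ A B | hom-∘ A | hom-¬ A | hom-∘ B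
    with to (z₃-→̃ (v A) (v B)) h
  ... | inj₁ (a , F-B) =
    ⊥-elim ([ (λ ¬a → contradiction (trans (sym a) ¬a) λ ())
            , IsF⇒¬Designated (v B) F-B ] ¬a⊎b)
  ... | inj₂ (inj₁ (¬A , ∘A)) = inj₁ (∘A , ¬A)
  ... | inj₂ (inj₂ (b , ∘B)) = inj₂ (∘B , b)
  IsBivaluationLETK⁺.vp17 ρ-isBivaluationLETK⁺ A B h a _
    rewrite hom-∘ (A ⇒' B) | hom-⇒ A B | hom-∘ B
    with to (z₃-→̃ (v A) (v B)) h
  ... | inj₁ (_ , (_ , ∘B)) = ∘B
  ... | inj₂ (inj₁ F-A) = ⊥-elim (IsF⇒¬Designated (v A) F-A a)
  ... | inj₂ (inj₂ (_ , ∘B)) = ∘B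

proposition3p11 : (v : For → B6) → IsValuation v →
    IsBivaluationLETK⁺ (ρ v) × (∀ A → (ρ v) A ≡ true ⇔ Designated (v A))
proposition3p11 v hv = ρ-isBivaluationLETK⁺ hv , λ _ → ⇔-refl
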